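{- If $M=(E,\mathcal{B})$ is a uniformly dense loopless matroid that has a circuit, then $\operatorname{gir}(M)\ge\rho(M)/(\rho(M)-1)$.
   Context: $\operatorname{rank}(A)=\max_{B\in\mathcal{B}}|B\cap A|$, $\rho(A)=|A|/\operatorname{rank}(A)$ for nonempty $A$, $\rho(M)=\rho(E)$; $M$ is uniformly dense if $\rho(A)\le\rho(E)$ for all nonempty $A\subseteq E$. A circuit is a set $C\subseteq E$ with $\operatorname{rank}(C)=|C|-1$ and $\operatorname{rank}(S)=|S|$ for every proper subset $S\subset C$; $\operatorname{gir}(M)$ is the minimum size of a circuit. -}

module Defs where

open import Data.Nat using (ℕ; _⊔_; _*_; _≤_; _∸_)
open import Data.Fin using (Fin)
open import Data.Fin.Subset using (Subset; _∩_; _∪_; _-_; ⁅_⁆; ∣_∣; _∈_; _∉_; _⊂_; ⊤; Nonempty)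
open import Data.List using (List; []; foldr; map)
import Data.List.Membership.Propositional as LM
open import Data.Product using (∃; _×_)
open import Relation.Nullary using (¬_)
open import Relation.Binary.PropositionalEquality using (_≡_; _≢_)

record Matroid (n : ℕ) : Set where
  field
    bases    : List (Subset n)
    nonempty : bases ≢ []
    exchange : ∀ {B₁ B₂} → B₁ LM.∈ bases → B₂ LM.∈ bases →
               ∀ x → x ∈ B₁ → x ∉ B₂ →
               ∃ λ y → y ∈ B₂ × y ∉ B₁ × ((B₁ - x) ∪ ⁅ y ⁆) LM.∈ bases

module _ {n : ℕ} (M : Matroid n) where
  open Matroid M

  rank : Subset n → ℕ
  rank A = foldr _⊔_ 0 (map (λ B → ∣ B ∩ A ∣) bases)

  -- C is a circuit: rank(C) = |C| - 1 and every proper subset S ⊂ C has rank(S) = |S|.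
  -- (rank C + 1 ≡ ∣ C ∣ is |C| - 1 = rank C without truncated subtraction.)
  IsCircuit : Subset n → Set
  IsCircuit C = (rank C Data.Nat.+ 1 ≡ ∣ C ∣) × (∀ S → S ⊂ C → rank S ≡ ∣ S ∣)

  Loopless : Set
  Loopless = ∀ x → ¬ IsCircuit ⁅ x ⁆

  -- uniformly dense: ρ(A) ≤ ρ(E) for all nonempty A, i.e.
  -- |A| / rank(A) ≤ |E| / rank(E), cross-multiplied (rank(A) = 0 means ρ(A) = ∞).
  UniformlyDense : Set
  UniformlyDense = ∀ A → Nonempty A → ∣ A ∣ * rank ⊤ ≤ n * rank A

-- A circuit C has rank |C| - 1, so uniform density applied to C reads
-- |C| · rank E ≤ n (|C| - 1), which rearranges to n ≤ |C| (n - rank E).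
module Submission where

open import Defs
open import Data.Nat using (ℕ; _*_; _≤_; _∸_; _+_)
open import Data.Nat.Properties
  using (1+n≢0; +-comm; *-comm; *-distribˡ-∸; +-monoʳ-≤; m+n≤o⇒m≤o∸n)
open import Data.Fin.Subset using (Subset; ∣_∣; ⊤; Nonempty)
open import Data.Fin.Subset.Properties using (nonempty?; Empty-unique; ∣⊥∣≡0)
open import Data.Product using (∃; _,_)
open import Relation.Nullary using (yes; no; contradiction)
open import Relation.Binary.PropositionalEquality
  using (_≡_; sym; trans; cong; subst; module ≡-Reasoning)

n≤[k+1]*[n∸r] : ∀ n k r → (k + 1) * r ≤ n * k → n ≤ (k + 1) * (n ∸ r)
n≤[k+1]*[n∸r] n k r dense =
  subst (n ≤_) (sym (*-distribˡ-∸ (k + 1) n r))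
    (m+n≤o⇒m≤o∸n n (subst (n + (k + 1) * r ≤_) (sym [k+1]*n≡n+n*k)
                                              (+-monoʳ-≤ n dense)))
  where
  open ≡-Reasoning
  [k+1]*n≡n+n*k : (k + 1) * n ≡ n + n * k
  [k+1]*n≡n+n*k = begin
    (k + 1) * n ≡⟨ cong (_* n) (+-comm k 1) ⟩
    n + k * n   ≡⟨ cong (n +_) (*-comm k n) ⟩
    n + n * k   ∎

module _ {n : ℕ} (M : Matroid n) where

  circuit-nonempty : ∀ {C} → IsCircuit M C → Nonempty C
  circuit-nonempty {C} (rank+1≡∣C∣ , _) with nonempty? C
  ... | yes ne = ne
  ... | no ¬ne = contradiction
    (trans (+-comm 1 (rank M C))
      (trans rank+1≡∣C∣ (trans (cong ∣_∣ (Empty-unique ¬ne)) (∣⊥∣≡0 n))))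
    1+n≢0

proposition3p9 : ∀ (n : ℕ) (M : Matroid n) → UniformlyDense M → Loopless M →
    ∃ (λ C → IsCircuit M C) →
    ∀ (C : Subset n) → IsCircuit M C → n ≤ ∣ C ∣ * (n ∸ rank M ⊤)
proposition3p9 n M dense _ _ C circuit@(rank+1≡∣C∣ , _) =
  subst (λ c → n ≤ c * (n ∸ rank M ⊤)) rank+1≡∣C∣
    (n≤[k+1]*[n∸r] n (rank M C) (rank M ⊤)
      (subst (λ c → c * rank M ⊤ ≤ n * rank M C) (sym rank+1≡∣C∣)
        (dense C (circuit-nonempty M circuit))))
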